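{- $\mathrm{(1)}$ For any $n$, and for all $m\geq 1$, \[ b_m(\ell^2 n)-\ell^{2\lambda-1} b_{m-1}(n)=a_0(\ell^{2m+2}n)-\chi(\ell)\ell^{\lambda-1} a_0(\ell^{2m}n). \] $\mathrm{(2)}$ If $\ell \nmid n$, then for all $m\geq 1$, \[ b_m(n)=a_0(\ell^{2m}n)+\left(1-\left(\frac{(-1)^{\lambda}n}{\ell}\right)\right)\sum_{k=1}^{m}(-1)^k\chi(\ell)^{k}\ell^{(\lambda-1)k}a_0(\ell^{2m-2k}n). \] $\mathrm{(3)}$ If $\ell \parallel n$, then for all $m\geq 1$, \[ b_m(n)=a_0(\ell^{2m}n)-\chi(\ell)\ell^{\lambda-1}a_0(\ell^{2m-2}n). \]
   Context: Let $\lambda$ be an integer, $\ell$ a prime with $\ell\nmid N$, and $\chi$ a quadratic character with conductor coprime to $\ell$. Let $f(\tau)=\sum_{n\in\mathbb{Z}}a(n)q^n$ be a weakly holomorphic modular form of weight $\lambda+\tfrac12$ with Nebentypus $\chi$ on $\Gamma_0(4N)$ (holomorphic on the upper half plane, poles only at cusps). The half-integral weight Hecke operator $T_{\ell^2}$ acts by \[ f\mid T_{\ell^2}=\sum_{n}\Big(a(\ell^2n)+\Big(\tfrac{(-1)^\lambda n}{\ell}\Big)\chi(\ell)\ell^{\lambda-1}a(n)+\ell^{2\lambda-1}a(n/\ell^2)\Big)q^n, \] where $a(n/\ell^2)=0$ if $\ell^2\nmid n$; $T_1$ is the identity, and for $m\ge1$, $T_{\ell^{2m+2}}=T_{\ell^2}T_{\ell^{2m}}-\chi(\ell^2)\ell^{2\lambda-1}T_{\ell^{2m-2}}$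 (here $\chi(\ell^2)=1$). Write $f\mid T_{\ell^{2m}}=\sum_n a_m(n)q^n$, so $a_0(n)=a(n)$. Define $B_0(\tau)=f(\tau)$ and, for $m\ge1$, \[ B_m(\tau)=\sum_n b_m(n)q^n:=f\mid T_{\ell^{2m}}-\chi(\ell)\ell^{\lambda-1}f\mid T_{\ell^{2m-2}}. \] $\ell\parallel n$ means $\ell\mid n$ but $\ell^2\nmid n$; $\left(\frac{\cdot}{\ell}\right)$ is the Legendre symbol. -}

module Defs where

open import Level using (Level)
open import Algebra.Bundles using (CommutativeRing)
open import Data.Bool using (Bool; true; false; if_then_else_)
open import Data.Nat as ℕ using (ℕ; zero; suc)
open import Data.Integer as ℤ using (ℤ; +_; -[1+_]; ∣_∣; 0ℤ; 1ℤ; -1ℤ)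
open import Data.List using (List; upTo)
open import Data.Bool.ListAction using (any)

legendre : ℤ → ℕ → ℤ
legendre a zero = 0ℤ
legendre a (suc k) with a ℤ.%ℕ suc k
... | zero = 0ℤ
... | suc r =
  if any (λ x → ((x ℕ.* x) ℕ.% suc k) ℕ.≡ᵇ suc r) (upTo (suc k))
  then 1ℤ else -1ℤ

minusOnePow : ℤ → ℤ
minusOnePow λ' with ∣ λ' ∣ ℕ.% 2
... | zero = 1ℤ
... | suc _ = -1ℤ

divides? : ℕ → ℤ → Bool
divides? zero n = false
divides? (suc d) n = (n ℤ.%ℕ suc d) ℕ.≡ᵇ 0

quot : ℕ → ℤ → ℤ
quot zero n = 0ℤ
quot (suc d) n = n ℤ./ℕ suc d

-- Ring-valued notions.  Coefficients live in a commutative ring R in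
-- which ℓ is invertible (e.g. ℂ); ℓ^k for k : ℤ is formed using ℓ⁻¹.

module _ {c r : Level} (R : CommutativeRing c r) where
  open CommutativeRing R

  natR : ℕ → Carrier
  natR zero = 0#
  natR (suc n) = 1# + natR n

  intR : ℤ → Carrier
  intR (+ n) = natR n
  intR -[1+ n ] = - natR (suc n)

  npow : Carrier → ℕ → Carrier
  npow x zero = 1#
  npow x (suc k) = x * npow x k

  zpow : Carrier → Carrier → ℤ → Carrier
  zpow x xinv (+ k) = npow x k
  zpow x xinv -[1+ k ] = npow xinv (suc k)

  sum1to : ℕ → (ℕ → Carrier) → Carrier
  sum1to zero f = 0#
  sum1to (suc m) f = sum1to m f + f (suc m)

  module Hecke (λ' : ℤ) (ℓ : ℕ) (ℓinv : Carrier) (χℓ : ℤ) where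

    ℓpow : ℤ → Carrier
    ℓpow = zpow (natR ℓ) ℓinv

    c₁ : Carrier
    c₁ = intR χℓ * ℓpow (λ' ℤ.- 1ℤ)

    c₂ : Carrier
    c₂ = ℓpow ((+ 2) ℤ.* λ' ℤ.- 1ℤ)

    -- f ↦ f | T_{ℓ²} on coefficient functions n ↦ a(n)
    T : (ℤ → Carrier) → (ℤ → Carrier)
    T a n = a ((+ (ℓ ℕ.* ℓ)) ℤ.* n)
          + (intR (legendre (minusOnePow λ' ℤ.* n) ℓ) * c₁) * a n
          + (if divides? (ℓ ℕ.* ℓ) n then c₂ * a (quot (ℓ ℕ.* ℓ) n) else 0#)

    -- f ↦ f | T_{ℓ^{2m}}
    Tpow : ℕ → (ℤ → Carrier) → (ℤ → Carrier)
    Tpow zero a = a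
    Tpow (suc zero) a = T a
    Tpow (suc (suc m)) a n = T (Tpow (suc m) a) n - c₂ * Tpow m a n

    b : (ℤ → Carrier) → ℕ → ℤ → Carrier
    b a zero = a
    b a (suc m) n = Tpow (suc m) a n - c₁ * Tpow m a n

-- In T X (ℓ²n) the Legendre term vanishes and ℓ² divides ℓ²n, so
-- T X (ℓ²n) = X (ℓ⁴n) + ℓ^(2λ-1) X n.  Fed into the three-term recursion for
-- T_{ℓ^{2m}}, this makes a_m(ℓ²n) - ℓ^(2λ-1) a_{m-1}(n) = a(ℓ^(2m+2) n) telescope,
-- which gives (1); when ℓ ∥ n also T X n = X (ℓ²n), so a_m(n) = a(ℓ^(2m) n) and (3)
-- follows.  When ℓ ∤ n the Legendre symbol ε is ±1 and
-- a_{m+1}(n) = a(ℓ^(2m+2) n) + ε χ(ℓ) ℓ^(λ-1) a_m(n); since (1 - ε) ε = -(1 - ε),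
-- multiplying by 1 - ε turns every power of ε into the same power of -1, which is (2).

module Submission where

open import Defs
open import Level using (Level)
open import Algebra.Bundles using (CommutativeRing)
open import Data.Nat as ℕ using (ℕ; zero; suc)
open import Data.Nat.Primality using (Prime; ¬prime[0])
open import Data.Integer as ℤ using (ℤ; +_; -[1+_]; +0; +[1+_]; 0ℤ; 1ℤ; -1ℤ; ∣_∣)
open import Data.Integer.Divisibility using (_∣_)
open import Data.Product using (_×_; _,_)
open import Data.Sum using (_⊎_; inj₁; inj₂)
open import Data.Bool using (true; false; if_then_else_)
open import Data.Maybe using (Maybe; just; nothing)
open import Data.Empty using (⊥-elim)
open import Relation.Nullary using (¬_; yes; no)
open import Relation.Binary.PropositionalEquality using (_≡_)
import Relation.Binary.PropositionalEquality as ≡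
import Data.Nat.Properties as ℕ
import Data.Nat.Divisibility as ℕ
import Data.Nat.DivMod as ℕ
import Data.Integer.Properties as ℤ
import Data.Integer.DivMod as ℤ
import Data.Sign as Sign
open import Function using (_∘_)

-- The ring solver compares normal forms by computation, so its coefficients must be
-- concrete: we use ℤ, acting on R through the homomorphism intR.

module IntegerCoefficientSolver {c r : Level} (R : CommutativeRing c r) where
  open CommutativeRing R
  open import Relation.Binary.Reasoning.Setoid setoid
  open import Algebra.Properties.Semiring.Mult semiring using (×-homo-+; ×1-homo-*) renaming (_×_ to _×ᴿ_)
  open import Algebra.Properties.Ring ring using (-‿distribˡ-*; -‿distribʳ-*)
  open import Algebra.Properties.AbelianGroup +-abelianGroup using (⁻¹-∙-comm)
  open import Algebra.Properties.Group +-group using (ε⁻¹≈ε; ⁻¹-involutive)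
  open import Algebra.Solver.Ring.AlmostCommutativeRing
    using (AlmostCommutativeRing; fromCommutativeRing; _-Raw-AlmostCommutative⟶_)

  natR≡×1# : ∀ n → natR R n ≡ n ×ᴿ 1#
  natR≡×1# zero = ≡.refl
  natR≡×1# (suc n) = ≡.cong (_+_ 1#) (natR≡×1# n)

  natR-+ : ∀ m n → natR R (m ℕ.+ n) ≈ natR R m + natR R n
  natR-+ m n rewrite natR≡×1# (m ℕ.+ n) | natR≡×1# m | natR≡×1# n = ×-homo-+ 1# m n

  natR-* : ∀ m n → natR R (m ℕ.* n) ≈ natR R m * natR R n
  natR-* m n rewrite natR≡×1# (m ℕ.* n) | natR≡×1# m | natR≡×1# n = ×1-homo-* m n

  intR-⊖ : ∀ m n → intR R (m ℤ.⊖ n) ≈ natR R m - natR R n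
  intR-⊖ zero zero = sym (trans (+-congˡ ε⁻¹≈ε) (+-identityʳ 0#))
  intR-⊖ zero (suc n) = sym (+-identityˡ _)
  intR-⊖ (suc m) zero = sym (trans (+-congˡ ε⁻¹≈ε) (+-identityʳ _))
  intR-⊖ (suc m) (suc n) = begin
    intR R (suc m ℤ.⊖ suc n)          ≡⟨ ≡.cong (intR R) (ℤ.[1+m]⊖[1+n]≡m⊖n m n) ⟩
    intR R (m ℤ.⊖ n)                  ≈⟨ intR-⊖ m n ⟩
    natR R m - natR R n               ≈⟨ cancel 1# (natR R m) (natR R n) ⟨
    natR R (suc m) - natR R (suc n)   ∎
    where
    cancel : ∀ x y z → (x + y) - (x + z) ≈ y - z
    cancel x y z = begin
      (x + y) + - (x + z)     ≈⟨ +-congˡ (⁻¹-∙-comm x z) ⟨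
      (x + y) + (- x + - z)   ≈⟨ +-congʳ (+-comm x y) ⟩
      (y + x) + (- x + - z)   ≈⟨ +-assoc y x _ ⟩
      y + (x + (- x + - z))   ≈⟨ +-congˡ (+-assoc x (- x) (- z)) ⟨
      y + ((x + - x) + - z)   ≈⟨ +-congˡ (+-congʳ (-‿inverseʳ x)) ⟩
      y + (0# + - z)          ≈⟨ +-congˡ (+-identityˡ (- z)) ⟩
      y - z                   ∎

  intR-neg : ∀ i → intR R (ℤ.- i) ≈ - intR R i
  intR-neg -[1+ n ] = sym (⁻¹-involutive _)
  intR-neg +0 = sym ε⁻¹≈ε
  intR-neg +[1+ n ] = refl

  intR-+ : ∀ i j → intR R (i ℤ.+ j) ≈ intR R i + intR R j
  intR-+ (+ m) (+ n) = natR-+ m n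
  intR-+ (+ m) -[1+ n ] = intR-⊖ m (suc n)
  intR-+ -[1+ m ] (+ n) = trans (intR-⊖ n (suc m)) (+-comm _ _)
  intR-+ -[1+ m ] -[1+ n ] = begin
    intR R (-[1+ m ] ℤ.+ -[1+ n ])       ≡⟨ ≡.cong (intR R) (ℤ.neg-distrib-+ (+[1+ m ]) (+[1+ n ])) ⟨
    intR R (ℤ.- (+[1+ m ] ℤ.+ +[1+ n ])) ≈⟨ intR-neg (+[1+ m ] ℤ.+ +[1+ n ]) ⟩
    - natR R (suc m ℕ.+ suc n)           ≈⟨ -‿cong (natR-+ (suc m) (suc n)) ⟩
    - (natR R (suc m) + natR R (suc n))  ≈⟨ ⁻¹-∙-comm _ _ ⟨
    intR R -[1+ m ] + intR R -[1+ n ]    ∎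

  intR-*-pos : ∀ m n → intR R (+ m ℤ.* + n) ≈ natR R m * natR R n
  intR-*-pos m n = begin
    intR R (+ m ℤ.* + n)   ≡⟨ ≡.cong (intR R) (ℤ.pos-* m n) ⟨
    natR R (m ℕ.* n)       ≈⟨ natR-* m n ⟩
    natR R m * natR R n    ∎

  intR-*-posˡ : ∀ m j → intR R (+ m ℤ.* j) ≈ natR R m * intR R j
  intR-*-posˡ m (+ n) = intR-*-pos m n
  intR-*-posˡ m -[1+ n ] = begin
    intR R (+ m ℤ.* ℤ.- +[1+ n ])    ≡⟨ ≡.cong (intR R) (ℤ.neg-distribʳ-* (+ m) +[1+ n ]) ⟨
    intR R (ℤ.- (+ m ℤ.* +[1+ n ]))  ≈⟨ intR-neg (+ m ℤ.* +[1+ n ]) ⟩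
    - intR R (+ m ℤ.* +[1+ n ])      ≈⟨ -‿cong (intR-*-pos m (suc n)) ⟩
    - (natR R m * natR R (suc n))    ≈⟨ -‿distribʳ-* _ _ ⟩
    natR R m * intR R -[1+ n ]       ∎

  intR-* : ∀ i j → intR R (i ℤ.* j) ≈ intR R i * intR R j
  intR-* (+ m) j = intR-*-posˡ m j
  intR-* -[1+ m ] j = begin
    intR R (ℤ.- +[1+ m ] ℤ.* j)     ≡⟨ ≡.cong (intR R) (ℤ.neg-distribˡ-* +[1+ m ] j) ⟨
    intR R (ℤ.- (+[1+ m ] ℤ.* j))   ≈⟨ intR-neg (+[1+ m ] ℤ.* j) ⟩
    - intR R (+[1+ m ] ℤ.* j)       ≈⟨ -‿cong (intR-*-posˡ (suc m) j) ⟩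
    - (natR R (suc m) * intR R j)   ≈⟨ -‿distribˡ-* _ _ ⟩
    intR R -[1+ m ] * intR R j      ∎

  R′ : AlmostCommutativeRing c r
  R′ = fromCommutativeRing R

  intR-homomorphism : ℤ.+-*-rawRing -Raw-AlmostCommutative⟶ R′
  intR-homomorphism = record
    { ⟦_⟧    = intR R
    ; +-homo = intR-+
    ; *-homo = intR-*
    ; -‿homo = intR-neg
    ; 0-homo = refl
    ; 1-homo = +-identityʳ 1#
    }

  ℤ-equal? : ∀ i j → Maybe (intR R i ≈ intR R j)
  ℤ-equal? i j with i ℤ.≟ j
  ... | yes ≡.refl = just refl
  ... | no _ = nothing

  open import Algebra.Solver.Ring ℤ.+-*-rawRing R′ intR-homomorphism ℤ-equal? public

module CommutativeRingFacts {c r : Level} (R : CommutativeRing c r) where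
  open CommutativeRing R
  open IntegerCoefficientSolver R using (solve; _:=_; _:+_; _:-_; _:*_; :-_)
  open import Relation.Binary.Reasoning.Setoid setoid
  open import Algebra.Properties.CommutativeSemiring.Exp commutativeSemiring
    using (_^_; ^-congˡ; ^-distrib-*; ^-assocʳ)
  open import Algebra.Properties.Ring ring using (-1*x≈-x; [y-z]x≈yx-zx)

  npow≡^ : ∀ x n → npow R x n ≡ x ^ n
  npow≡^ x zero = ≡.refl
  npow≡^ x (suc n) = ≡.cong (x *_) (npow≡^ x n)

  npow-congˡ : ∀ n {x y} → x ≈ y → npow R x n ≈ npow R y n
  npow-congˡ n {x} {y} x≈y rewrite npow≡^ x n | npow≡^ y n = ^-congˡ n x≈y

  npow-distrib-* : ∀ x y n → npow R (x * y) n ≈ npow R x n * npow R y n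
  npow-distrib-* x y n rewrite npow≡^ (x * y) n | npow≡^ x n | npow≡^ y n = ^-distrib-* x y n

  npow-assoc : ∀ x m n → npow R (npow R x m) n ≈ npow R x (m ℕ.* n)
  npow-assoc x m n rewrite npow≡^ x m | npow≡^ (x ^ m) n | npow≡^ x (m ℕ.* n) = ^-assocʳ x m n

  npow-neg-distrib-* : ∀ x y n →
    npow R (- (x * y)) n ≈ npow R (- 1#) n * npow R x n * npow R y n
  npow-neg-distrib-* x y n = begin
    npow R (- (x * y)) n                        ≈⟨ npow-congˡ n (-1*x≈-x (x * y)) ⟨
    npow R (- 1# * (x * y)) n                   ≈⟨ npow-distrib-* (- 1#) (x * y) n ⟩
    npow R (- 1#) n * npow R (x * y) n          ≈⟨ *-congˡ (npow-distrib-* x y n) ⟩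
    npow R (- 1#) n * (npow R x n * npow R y n) ≈⟨ *-assoc _ _ _ ⟨
    npow R (- 1#) n * npow R x n * npow R y n   ∎

  zpow-*-+ : ∀ x y z n → zpow R x y (z ℤ.* + n) ≈ npow R (zpow R x y z) n
  zpow-*-+ x y (+ m) n = begin
    zpow R x y (Sign.+ ℤ.◃ m ℕ.* n)      ≡⟨ zpow-+◃ (m ℕ.* n) ⟩
    npow R x (m ℕ.* n)                   ≈⟨ npow-assoc x m n ⟨
    npow R (npow R x m) n                ∎
    where
    zpow-+◃ : ∀ k → zpow R x y (Sign.+ ℤ.◃ k) ≡ npow R x k
    zpow-+◃ zero = ≡.refl
    zpow-+◃ (suc k) = ≡.refl
  zpow-*-+ x y -[1+ m ] n = begin
    zpow R x y (Sign.- ℤ.◃ suc m ℕ.* n)  ≡⟨ zpow-−◃ (suc m ℕ.* n) ⟩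
    npow R y (suc m ℕ.* n)               ≈⟨ npow-assoc y (suc m) n ⟨
    npow R (npow R y (suc m)) n          ∎
    where
    zpow-−◃ : ∀ k → zpow R x y (Sign.- ℤ.◃ k) ≡ npow R y k
    zpow-−◃ zero = ≡.refl
    zpow-−◃ (suc k) = ≡.refl

  sum1to-cong : ∀ m {f g : ℕ → Carrier} → (∀ k → f k ≈ g k) → sum1to R m f ≈ sum1to R m g
  sum1to-cong zero f≈g = refl
  sum1to-cong (suc m) f≈g = +-cong (sum1to-cong m f≈g) (f≈g (suc m))

  sum1to-suc : ∀ m f → sum1to R (suc m) f ≈ f 1 + sum1to R m (λ k → f (suc k))
  sum1to-suc zero f = trans (+-identityˡ _) (sym (+-identityʳ _))
  sum1to-suc (suc m) f = trans (+-congʳ (sum1to-suc m f)) (+-assoc _ _ _)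

  sum1to-*ˡ : ∀ m x f → sum1to R m (λ k → x * f k) ≈ x * sum1to R m f
  sum1to-*ˡ zero x f = sym (zeroʳ x)
  sum1to-*ˡ (suc m) x f = trans (+-congʳ (sum1to-*ˡ m x f)) (sym (distribˡ x _ _))

  module SignedRecurrence {e γ : Carrier} (e*e≈1 : e * e ≈ 1#) (p A : ℕ → Carrier)
    (A-zero : A 0 ≈ p 0) (A-suc : ∀ m → A (suc m) ≈ p (suc m) + e * γ * A m) where

    signedSum : ℕ → Carrier
    signedSum m = sum1to R m (λ k → npow R (- γ) k * p (m ℕ.∸ k))

    signedSum-suc : ∀ m → signedSum (suc m) ≈ - γ * (p m + signedSum m)
    signedSum-suc m = begin
      signedSum (suc m)                                 ≈⟨ sum1to-suc m _ ⟩
      - γ * 1# * p m + sum1to R m (λ k → - γ * npow R (- γ) k * p (m ℕ.∸ k))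
        ≈⟨ +-cong (*-congʳ (*-identityʳ (- γ))) (sum1to-cong m (λ k → *-assoc _ _ _)) ⟩
      - γ * p m + sum1to R m (λ k → - γ * (npow R (- γ) k * p (m ℕ.∸ k)))
        ≈⟨ +-congˡ (sum1to-*ˡ m (- γ) _) ⟩
      - γ * p m + - γ * signedSum m                     ≈⟨ distribˡ (- γ) _ _ ⟨
      - γ * (p m + signedSum m)                         ∎

    [1-e]*e≈-[1-e] : (1# - e) * e ≈ - (1# - e)
    [1-e]*e≈-[1-e] = begin
      (1# - e) * e    ≈⟨ [y-z]x≈yx-zx e 1# e ⟩
      1# * e - e * e  ≈⟨ +-cong (*-identityˡ e) (-‿cong e*e≈1) ⟩
      e - 1#          ≈⟨ solve 2 (λ e o → e :- o := :- (o :- e)) refl e 1# ⟩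
      - (1# - e)      ∎

    [1-e]*A≈[1-e]*[p+signedSum] : ∀ m → (1# - e) * A m ≈ (1# - e) * (p m + signedSum m)
    [1-e]*A≈[1-e]*[p+signedSum] zero = *-congˡ (trans A-zero (sym (+-identityʳ (p 0))))
    [1-e]*A≈[1-e]*[p+signedSum] (suc m) = begin
      u * A (suc m)                           ≈⟨ *-congˡ (A-suc m) ⟩
      u * (p (suc m) + e * γ * A m)
        ≈⟨ solve 5 (λ u p e γ a → u :* (p :+ e :* γ :* a) := u :* p :+ (u :* e) :* (γ :* a))
                   refl u _ e γ _ ⟩
      u * p (suc m) + u * e * (γ * A m)
        ≈⟨ +-congˡ (*-congʳ [1-e]*e≈-[1-e]) ⟩
      u * p (suc m) + - u * (γ * A m)
        ≈⟨ solve 4 (λ u p γ a → u :* p :+ (:- u) :* (γ :* a) := u :* p :+ (:- γ) :* (u :* a))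
                   refl u _ γ _ ⟩
      u * p (suc m) + - γ * (u * A m)
        ≈⟨ +-congˡ (*-congˡ ([1-e]*A≈[1-e]*[p+signedSum] m)) ⟩
      u * p (suc m) + - γ * (u * (p m + signedSum m))
        ≈⟨ solve 4 (λ u p γ s → u :* p :+ (:- γ) :* (u :* s) := u :* (p :+ (:- γ) :* s))
                   refl u _ γ _ ⟩
      u * (p (suc m) + - γ * (p m + signedSum m))
        ≈⟨ *-congˡ (+-congˡ (signedSum-suc m)) ⟨
      u * (p (suc m) + signedSum (suc m))
        ∎
      where
      u : Carrier
      u = 1# - e

    A-suc-minus : ∀ m → A (suc m) - γ * A m ≈ p (suc m) + (1# - e) * signedSum (suc m)
    A-suc-minus m = begin
      A (suc m) - γ * A m
        ≈⟨ +-congʳ (A-suc m) ⟩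
      p (suc m) + e * γ * A m - γ * A m
        ≈⟨ solve 4 (λ p e γ a → p :+ e :* γ :* a :- γ :* a := p :+ (:- γ) :* (a :- e :* a))
                   refl _ e γ _ ⟩
      p (suc m) + - γ * (A m - e * A m)
        ≈⟨ +-congˡ (*-congˡ (trans ([y-z]x≈yx-zx (A m) 1# e) (+-congʳ (*-identityˡ (A m))))) ⟨
      p (suc m) + - γ * ((1# - e) * A m)
        ≈⟨ +-congˡ (*-congˡ ([1-e]*A≈[1-e]*[p+signedSum] m)) ⟩
      p (suc m) + - γ * ((1# - e) * (p m + signedSum m))
        ≈⟨ solve 4 (λ p γ u s → p :+ (:- γ) :* (u :* s) := p :+ u :* ((:- γ) :* s))
                   refl _ γ (1# - e) _ ⟩
      p (suc m) + (1# - e) * (- γ * (p m + signedSum m))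
        ≈⟨ +-congˡ (*-congˡ (signedSum-suc m)) ⟨
      p (suc m) + (1# - e) * signedSum (suc m)
        ∎

%ℕ≡0⇒∣ : ∀ d i → i ℤ.%ℕ suc d ≡ 0 → + suc d ∣ i
%ℕ≡0⇒∣ d (+ n) i%d≡0 = ℕ.m%n≡0⇒n∣m n (suc d) i%d≡0
%ℕ≡0⇒∣ d -[1+ n ] i%d≡0 with suc n ℕ.% suc d in eq
... | zero = ℕ.m%n≡0⇒n∣m (suc n) (suc d) eq
... | suc r = ⊥-elim (ℕ.<⇒≱ r<d (ℕ.m∸n≡0⇒m≤n i%d≡0))
  where
  r<d : suc r ℕ.< suc d
  r<d = ≡.subst (ℕ._< suc d) eq (ℕ.m%n<n (suc n) (suc d))

∣⇒%ℕ≡0 : ∀ d i → + suc d ∣ i → i ℤ.%ℕ suc d ≡ 0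
∣⇒%ℕ≡0 d (+ n) d∣i = ℕ.n∣m⇒m%n≡0 n (suc d) d∣i
∣⇒%ℕ≡0 d -[1+ n ] d∣i with suc n ℕ.% suc d in eq
... | zero = ≡.refl
... | suc r with () ← ≡.trans (≡.sym eq) (ℕ.n∣m⇒m%n≡0 (suc n) (suc d) d∣i)

+m∣+m*i : ∀ m i → + m ∣ + m ℤ.* i
+m∣+m*i m i = ≡.subst (m ℕ.∣_) (≡.sym (ℤ.abs-* (+ m) i)) (ℕ.m∣m*n ∣ i ∣)

∣minusOnePow*i∣≡∣i∣ : ∀ λ' i → ∣ minusOnePow λ' ℤ.* i ∣ ≡ ∣ i ∣
∣minusOnePow*i∣≡∣i∣ λ' i = begin
  ∣ minusOnePow λ' ℤ.* i ∣       ≡⟨ ℤ.abs-* (minusOnePow λ') i ⟩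
  ∣ minusOnePow λ' ∣ ℕ.* ∣ i ∣   ≡⟨ ≡.cong (ℕ._* ∣ i ∣) ∣minusOnePow∣≡1 ⟩
  1 ℕ.* ∣ i ∣                   ≡⟨ ℕ.*-identityˡ ∣ i ∣ ⟩
  ∣ i ∣                         ∎
  where
  open ≡.≡-Reasoning
  ∣minusOnePow∣≡1 : ∣ minusOnePow λ' ∣ ≡ 1
  ∣minusOnePow∣≡1 with ∣ λ' ∣ ℕ.% 2
  ... | zero = ≡.refl
  ... | suc _ = ≡.refl

legendre-∣ : ∀ d i → + suc d ∣ i → legendre i (suc d) ≡ 0ℤ
legendre-∣ d i d∣i with i ℤ.%ℕ suc d | ∣⇒%ℕ≡0 d i d∣i
... | zero | _ = ≡.refl

legendre-∤ : ∀ d i → ¬ (+ suc d ∣ i) → legendre i (suc d) ≡ 1ℤ ⊎ legendre i (suc d) ≡ -1ℤ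
legendre-∤ d i d∤i with i ℤ.%ℕ suc d in eq
... | zero = ⊥-elim (d∤i (%ℕ≡0⇒∣ d i eq))
... | suc r = ±1 _
  where
  ±1 : ∀ b → (if b then 1ℤ else -1ℤ) ≡ 1ℤ ⊎ (if b then 1ℤ else -1ℤ) ≡ -1ℤ
  ±1 true = inj₁ ≡.refl
  ±1 false = inj₂ ≡.refl

divides?-∣ : ∀ d i → + suc d ∣ i → divides? (suc d) i ≡ true
divides?-∣ d i d∣i = ≡.cong (ℕ._≡ᵇ 0) (∣⇒%ℕ≡0 d i d∣i)

divides?-∤ : ∀ d i → ¬ (+ suc d ∣ i) → divides? (suc d) i ≡ false
divides?-∤ d i d∤i with i ℤ.%ℕ suc d in eq
... | zero = ⊥-elim (d∤i (%ℕ≡0⇒∣ d i eq))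
... | suc _ = ≡.refl

quot-* : ∀ d i → quot (suc d) (+ suc d ℤ.* i) ≡ i
quot-* d i = ℤ.*-cancelʳ-≡ q i (+ suc d) (begin
  q ℤ.* + suc d                        ≡⟨ ℤ.+-identityˡ _ ⟨
  + 0 ℤ.+ q ℤ.* + suc d                ≡⟨ ≡.cong (λ r → + r ℤ.+ q ℤ.* + suc d) j%d≡0 ⟨
  + (j ℤ.%ℕ suc d) ℤ.+ q ℤ.* + suc d   ≡⟨ ℤ.a≡a%ℕn+[a/ℕn]*n j (suc d) ⟨
  + suc d ℤ.* i                        ≡⟨ ℤ.*-comm (+ suc d) i ⟩
  i ℤ.* + suc d                        ∎)
  where
  open ≡.≡-Reasoning
  j q : ℤ
  j = + suc d ℤ.* i
  q = j ℤ./ℕ suc d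
  j%d≡0 : j ℤ.%ℕ suc d ≡ 0
  j%d≡0 = ∣⇒%ℕ≡0 d j (+m∣+m*i (suc d) i)

2[1+j]≡2j+2 : ∀ j → 2 ℕ.* suc j ≡ 2 ℕ.* j ℕ.+ 2
2[1+j]≡2j+2 j = ≡.trans (ℕ.*-suc 2 j) (ℕ.+-comm 2 (2 ℕ.* j))

module Dilation (k : ℕ) where
  ℓ : ℕ
  ℓ = suc k

  ℓ²·_ : ℤ → ℤ
  ℓ²· n = + (ℓ ℕ.* ℓ) ℤ.* n

  ℓ²^_·_ : ℕ → ℤ → ℤ
  ℓ²^ j · n = + (ℓ ℕ.^ (2 ℕ.* j)) ℤ.* n

  ℓ^2≡ℓ*ℓ : ℓ ℕ.^ 2 ≡ ℓ ℕ.* ℓ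
  ℓ^2≡ℓ*ℓ = ≡.cong (ℓ ℕ.*_) (ℕ.*-identityʳ ℓ)

  ℓ²^-zero : ∀ n → ℓ²^ 0 · n ≡ n
  ℓ²^-zero = ℤ.*-identityˡ

  ℓ²^-suc : ∀ j n → ℓ²^ suc j · n ≡ ℓ²^ j · (ℓ²· n)
  ℓ²^-suc j n = begin
    + (ℓ ℕ.^ (2 ℕ.* suc j)) ℤ.* n
      ≡⟨ ≡.cong (λ e → + (ℓ ℕ.^ e) ℤ.* n) (2[1+j]≡2j+2 j) ⟩
    + (ℓ ℕ.^ (2 ℕ.* j ℕ.+ 2)) ℤ.* n
      ≡⟨ ≡.cong (λ m → + m ℤ.* n) (ℕ.^-distribˡ-+-* ℓ (2 ℕ.* j) 2) ⟩
    + (ℓ ℕ.^ (2 ℕ.* j) ℕ.* ℓ ℕ.^ 2) ℤ.* n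
      ≡⟨ ≡.cong (λ m → + (ℓ ℕ.^ (2 ℕ.* j) ℕ.* m) ℤ.* n) ℓ^2≡ℓ*ℓ ⟩
    + (ℓ ℕ.^ (2 ℕ.* j) ℕ.* (ℓ ℕ.* ℓ)) ℤ.* n
      ≡⟨ ≡.cong (ℤ._* n) (ℤ.pos-* (ℓ ℕ.^ (2 ℕ.* j)) (ℓ ℕ.* ℓ)) ⟩
    + (ℓ ℕ.^ (2 ℕ.* j)) ℤ.* + (ℓ ℕ.* ℓ) ℤ.* n
      ≡⟨ ℤ.*-assoc (+ (ℓ ℕ.^ (2 ℕ.* j))) (+ (ℓ ℕ.* ℓ)) n ⟩
    ℓ²^ j · (ℓ²· n)
      ∎
    where open ≡.≡-Reasoning

  ℓ²^-one : ∀ n → ℓ²^ 1 · n ≡ ℓ²· n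
  ℓ²^-one n = ≡.trans (ℓ²^-suc 0 n) (ℓ²^-zero (ℓ²· n))

  ℓ∣ℓ²· : ∀ n → + ℓ ∣ ℓ²· n
  ℓ∣ℓ²· n = ℕ.∣-trans (ℕ.m∣m*n ℓ) (+m∣+m*i (ℓ ℕ.* ℓ) n)

  ℓ∤⇒ℓ²∤ : ∀ n → ¬ (+ ℓ ∣ n) → ¬ (+ (ℓ ℕ.* ℓ) ∣ n)
  ℓ∤⇒ℓ²∤ n ℓ∤n ℓ²∣n = ℓ∤n (ℕ.∣-trans (ℕ.m∣m*n ℓ) ℓ²∣n)

  ℓ∣minusOnePow* : ∀ λ' n → + ℓ ∣ minusOnePow λ' ℤ.* n → + ℓ ∣ n
  ℓ∣minusOnePow* λ' n = ≡.subst (ℓ ℕ.∣_) (∣minusOnePow*i∣≡∣i∣ λ' n)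

  ℓ∣*minusOnePow : ∀ λ' n → + ℓ ∣ n → + ℓ ∣ minusOnePow λ' ℤ.* n
  ℓ∣*minusOnePow λ' n = ≡.subst (ℓ ℕ.∣_) (≡.sym (∣minusOnePow*i∣≡∣i∣ λ' n))

module HeckeRecursion {c r : Level} (R : CommutativeRing c r) (λ' : ℤ) (k : ℕ)
  (ℓinv : CommutativeRing.Carrier R) (χℓ : ℤ) where
  open CommutativeRing R
  open IntegerCoefficientSolver R using (intR-*; solve; _:=_; _:+_; _:-_; _:*_; con)
  open CommutativeRingFacts R
  open Dilation k
  open Hecke R λ' ℓ ℓinv χℓ
  open import Relation.Binary.Reasoning.Setoid setoid

  ε : ℤ → Carrier
  ε n = intR R (legendre (minusOnePow λ' ℤ.* n) ℓ)

  ε-ℓ∣ : ∀ n → + ℓ ∣ n → ε n ≡ 0#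
  ε-ℓ∣ n ℓ∣n = ≡.cong (intR R) (legendre-∣ k (minusOnePow λ' ℤ.* n) (ℓ∣*minusOnePow λ' n ℓ∣n))

  ε*ε-ℓ∤ : ∀ n → ¬ (+ ℓ ∣ n) → ε n * ε n ≈ 1#
  ε*ε-ℓ∤ n ℓ∤n = begin
    ε n * ε n            ≈⟨ intR-* x x ⟨
    intR R (x ℤ.* x)     ≡⟨ ≡.cong (intR R) (±1*±1≡1 (legendre-∤ k i (ℓ∤n ∘ ℓ∣minusOnePow* λ' n))) ⟩
    1# + 0#              ≈⟨ +-identityʳ 1# ⟩
    1#                   ∎
    where
    i x : ℤ
    i = minusOnePow λ' ℤ.* n
    x = legendre i ℓ
    ±1*±1≡1 : ∀ {y} → y ≡ 1ℤ ⊎ y ≡ -1ℤ → y ℤ.* y ≡ 1ℤ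
    ±1*±1≡1 (inj₁ ≡.refl) = ≡.refl
    ±1*±1≡1 (inj₂ ≡.refl) = ≡.refl

  T-ℓ²· : ∀ X n → T X (ℓ²· n) ≈ X (ℓ²· ℓ²· n) + c₂ * X n
  T-ℓ²· X n = begin
    T X (ℓ²· n)
      ≡⟨ ≡.cong₂ (λ e y → X (ℓ²· ℓ²· n) + e * c₁ * X (ℓ²· n) + y)
                 (ε-ℓ∣ (ℓ²· n) (ℓ∣ℓ²· n)) ℓ²-branch ⟩
    X (ℓ²· ℓ²· n) + 0# * c₁ * X (ℓ²· n) + c₂ * X n
      ≈⟨ solve 5 (λ x γ y d z → x :+ con 0ℤ :* γ :* y :+ d :* z := x :+ d :* z) refl _ c₁ _ c₂ _ ⟩
    X (ℓ²· ℓ²· n) + c₂ * X n  ∎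
    where
    ℓ²-branch : (if divides? (ℓ ℕ.* ℓ) (ℓ²· n) then c₂ * X (quot (ℓ ℕ.* ℓ) (ℓ²· n)) else 0#)
                ≡ c₂ * X n
    ℓ²-branch rewrite divides?-∣ _ (ℓ²· n) (+m∣+m*i (ℓ ℕ.* ℓ) n)
                    | quot-* (k ℕ.+ k ℕ.* ℓ) n = ≡.refl

  T-ℓ²∤ : ∀ X n → ¬ (+ (ℓ ℕ.* ℓ) ∣ n) → T X n ≈ X (ℓ²· n) + ε n * c₁ * X n
  T-ℓ²∤ X n ℓ²∤n rewrite divides?-∤ _ n ℓ²∤n = +-identityʳ _

  T-ℓ∥ : ∀ X n → + ℓ ∣ n → ¬ (+ (ℓ ℕ.* ℓ) ∣ n) → T X n ≈ X (ℓ²· n)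
  T-ℓ∥ X n ℓ∣n ℓ²∤n = begin
    T X n                            ≈⟨ T-ℓ²∤ X n ℓ²∤n ⟩
    X (ℓ²· n) + ε n * c₁ * X n       ≡⟨ ≡.cong (λ e → X (ℓ²· n) + e * c₁ * X n) (ε-ℓ∣ n ℓ∣n) ⟩
    X (ℓ²· n) + 0# * c₁ * X n        ≈⟨ solve 3 (λ x γ y → x :+ con 0ℤ :* γ :* y := x) refl _ c₁ _ ⟩
    X (ℓ²· n)                        ∎

  module _ (a : ℤ → Carrier) where

    Tpow-ℓ²· : ∀ m n → Tpow (suc m) a (ℓ²· n) - c₂ * Tpow m a n ≈ a (ℓ²^ suc (suc m) · n)
    Tpow-ℓ²· zero n = begin
      T a (ℓ²· n) - c₂ * a n                 ≈⟨ +-congʳ (T-ℓ²· a n) ⟩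
      a (ℓ²· ℓ²· n) + c₂ * a n - c₂ * a n    ≈⟨ solve 3 (λ x d y → x :+ d :* y :- d :* y := x) refl _ c₂ _ ⟩
      a (ℓ²· ℓ²· n)                          ≡⟨ ≡.cong a (≡.trans (ℓ²^-suc 1 n) (ℓ²^-one (ℓ²· n))) ⟨
      a (ℓ²^ 2 · n)                          ∎
    Tpow-ℓ²· (suc m) n = begin
      T X (ℓ²· n) - c₂ * Tpow m a (ℓ²· n) - c₂ * X n
        ≈⟨ +-congʳ (+-congʳ (T-ℓ²· X n)) ⟩
      X (ℓ²· ℓ²· n) + c₂ * X n - c₂ * Tpow m a (ℓ²· n) - c₂ * X n
        ≈⟨ solve 4 (λ x d y w → x :+ d :* y :- d :* w :- d :* y := x :- d :* w) refl _ c₂ _ _ ⟩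
      X (ℓ²· ℓ²· n) - c₂ * Tpow m a (ℓ²· n)  ≈⟨ Tpow-ℓ²· m (ℓ²· n) ⟩
      a (ℓ²^ suc (suc m) · (ℓ²· n))          ≡⟨ ≡.cong a (ℓ²^-suc (suc (suc m)) n) ⟨
      a (ℓ²^ suc (suc (suc m)) · n)          ∎
      where
      X : ℤ → Carrier
      X = Tpow (suc m) a

    Tpow-ℓ∥ : ∀ n → + ℓ ∣ n → ¬ (+ (ℓ ℕ.* ℓ) ∣ n) → ∀ m → Tpow m a n ≈ a (ℓ²^ m · n)
    Tpow-ℓ∥ n ℓ∣n ℓ²∤n zero = reflexive (≡.cong a (≡.sym (ℓ²^-zero n)))
    Tpow-ℓ∥ n ℓ∣n ℓ²∤n (suc zero) =
      trans (T-ℓ∥ a n ℓ∣n ℓ²∤n) (reflexive (≡.cong a (≡.sym (ℓ²^-one n))))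
    Tpow-ℓ∥ n ℓ∣n ℓ²∤n (suc (suc m)) =
      trans (+-congʳ (T-ℓ∥ (Tpow (suc m) a) n ℓ∣n ℓ²∤n)) (Tpow-ℓ²· m n)

    Tpow-suc-ℓ∤ : ∀ n → ¬ (+ ℓ ∣ n) → ∀ m →
      Tpow (suc m) a n ≈ a (ℓ²^ suc m · n) + ε n * c₁ * Tpow m a n
    Tpow-suc-ℓ∤ n ℓ∤n zero =
      trans (T-ℓ²∤ a n (ℓ∤⇒ℓ²∤ n ℓ∤n)) (+-congʳ (reflexive (≡.cong a (≡.sym (ℓ²^-one n)))))
    Tpow-suc-ℓ∤ n ℓ∤n (suc m) = begin
      T X n - c₂ * Tpow m a n                           ≈⟨ +-congʳ (T-ℓ²∤ X n (ℓ∤⇒ℓ²∤ n ℓ∤n)) ⟩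
      X (ℓ²· n) + ε n * c₁ * X n - c₂ * Tpow m a n
        ≈⟨ solve 5 (λ x f y d w → x :+ f :* y :- d :* w := x :- d :* w :+ f :* y)
                   refl _ (ε n * c₁) _ c₂ _ ⟩
      X (ℓ²· n) - c₂ * Tpow m a n + ε n * c₁ * X n      ≈⟨ +-congʳ (Tpow-ℓ²· m n) ⟩
      a (ℓ²^ suc (suc m) · n) + ε n * c₁ * X n          ∎
      where
      X : ℤ → Carrier
      X = Tpow (suc m) a

    b-ℓ²· : ∀ n j →
      b a (suc j) (ℓ²· n) - c₂ * b a j n ≈ a (ℓ²^ suc (suc j) · n) - c₁ * a (ℓ²^ suc j · n)
    b-ℓ²· n zero = begin
      T a (ℓ²· n) - c₁ * a (ℓ²· n) - c₂ * a n
        ≈⟨ solve 5 (λ x γ y d z → x :- γ :* y :- d :* z := x :- d :* z :- γ :* y) refl _ c₁ _ c₂ _ ⟩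
      T a (ℓ²· n) - c₂ * a n - c₁ * a (ℓ²· n)
        ≈⟨ +-cong (Tpow-ℓ²· 0 n) (-‿cong (*-congˡ (reflexive (≡.cong a (≡.sym (ℓ²^-one n)))))) ⟩
      a (ℓ²^ 2 · n) - c₁ * a (ℓ²^ 1 · n) ∎
    b-ℓ²· n (suc j) = begin
      X - c₁ * Y - c₂ * (Z - c₁ * W)
        ≈⟨ solve 6 (λ x γ y d z w → x :- γ :* y :- d :* (z :- γ :* w)
                                    := x :- d :* z :- γ :* (y :- d :* w))
                   refl X c₁ Y c₂ Z W ⟩
      X - c₂ * Z - c₁ * (Y - c₂ * W)
        ≈⟨ +-cong (Tpow-ℓ²· (suc j) n) (-‿cong (*-congˡ (Tpow-ℓ²· j n))) ⟩
      a (ℓ²^ suc (suc (suc j)) · n) - c₁ * a (ℓ²^ suc (suc j) · n) ∎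
      where
      X Y Z W : Carrier
      X = Tpow (suc (suc j)) a (ℓ²· n)
      Y = Tpow (suc j) a (ℓ²· n)
      Z = Tpow (suc j) a n
      W = Tpow j a n

    b-ℓ∥ : ∀ n → + ℓ ∣ n → ¬ (+ (ℓ ℕ.* ℓ) ∣ n) → ∀ m →
      b a (suc m) n ≈ a (ℓ²^ suc m · n) - c₁ * a (ℓ²^ m · n)
    b-ℓ∥ n ℓ∣n ℓ²∤n m =
      +-cong (Tpow-ℓ∥ n ℓ∣n ℓ²∤n (suc m)) (-‿cong (*-congˡ (Tpow-ℓ∥ n ℓ∣n ℓ²∤n m)))

    b-ℓ∤ : ∀ n → ¬ (+ ℓ ∣ n) → ∀ m →
      b a (suc m) n ≈ a (ℓ²^ suc m · n)
        + (1# - ε n) * sum1to R (suc m) (λ j → npow R (- c₁) j * a (ℓ²^ (suc m ℕ.∸ j) · n))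
    b-ℓ∤ n ℓ∤n = A-suc-minus
      where
      open SignedRecurrence (ε*ε-ℓ∤ n ℓ∤n) (λ j → a (ℓ²^ j · n)) (λ j → Tpow j a n)
        (reflexive (≡.cong a (≡.sym (ℓ²^-zero n)))) (Tpow-suc-ℓ∤ n ℓ∤n)

    summand≈[-c₁]^j : ∀ n M j →
      npow R (- 1#) j * npow R (intR R χℓ) j * ℓpow ((λ' ℤ.- 1ℤ) ℤ.* + j)
        * a (+ (ℓ ℕ.^ (2 ℕ.* M ℕ.∸ 2 ℕ.* j)) ℤ.* n)
      ≈ npow R (- c₁) j * a (ℓ²^ (M ℕ.∸ j) · n)
    summand≈[-c₁]^j n M j = *-cong coefficient
      (reflexive (≡.cong (λ e → a (+ (ℓ ℕ.^ e) ℤ.* n)) (≡.sym (ℕ.*-distribˡ-∸ 2 M j))))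
      where
      coefficient :
        npow R (- 1#) j * npow R (intR R χℓ) j * ℓpow ((λ' ℤ.- 1ℤ) ℤ.* + j) ≈ npow R (- c₁) j
      coefficient = begin
        npow R (- 1#) j * npow R (intR R χℓ) j * ℓpow ((λ' ℤ.- 1ℤ) ℤ.* + j)
          ≈⟨ *-congˡ (zpow-*-+ (natR R ℓ) ℓinv (λ' ℤ.- 1ℤ) j) ⟩
        npow R (- 1#) j * npow R (intR R χℓ) j * npow R (ℓpow (λ' ℤ.- 1ℤ)) j
          ≈⟨ npow-neg-distrib-* (intR R χℓ) (ℓpow (λ' ℤ.- 1ℤ)) j ⟨
        npow R (- c₁) j ∎

proposition2p3 : ∀ {c r : Level} (R : CommutativeRing c r)
    (λ' : ℤ) (ℓ : ℕ) → Prime ℓ →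
    (ℓinv : CommutativeRing.Carrier R) →
    CommutativeRing._≈_ R (CommutativeRing._*_ R (natR R ℓ) ℓinv) (CommutativeRing.1# R) →
    (χℓ : ℤ) → (χℓ ≡ 1ℤ ⊎ χℓ ≡ -1ℤ) →
    (a : ℤ → CommutativeRing.Carrier R) →
    let open CommutativeRing R
        open Hecke R λ' ℓ ℓinv χℓ
    in
    (∀ (n : ℤ) (k : ℕ) →
      b a (suc k) (+ (ℓ ℕ.^ 2) ℤ.* n) - c₂ * b a k n
        ≈ a (+ (ℓ ℕ.^ (2 ℕ.* suc k ℕ.+ 2)) ℤ.* n)
          - c₁ * a (+ (ℓ ℕ.^ (2 ℕ.* suc k)) ℤ.* n))
    ×
    (∀ (n : ℤ) → ¬ (+ ℓ ∣ n) → ∀ (m : ℕ) → 1 ℕ.≤ m →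
      b a m n
        ≈ a (+ (ℓ ℕ.^ (2 ℕ.* m)) ℤ.* n)
          + (1# - intR R (legendre (minusOnePow λ' ℤ.* n) ℓ))
            * sum1to R m (λ k →
                npow R (- 1#) k * npow R (intR R χℓ) k
                * ℓpow ((λ' ℤ.- 1ℤ) ℤ.* + k)
                * a (+ (ℓ ℕ.^ (2 ℕ.* m ℕ.∸ 2 ℕ.* k)) ℤ.* n)))
    ×
    (∀ (n : ℤ) → + ℓ ∣ n → ¬ (+ (ℓ ℕ.^ 2) ∣ n) → ∀ (m : ℕ) → 1 ℕ.≤ m →
      b a m n
        ≈ a (+ (ℓ ℕ.^ (2 ℕ.* m)) ℤ.* n)
          - c₁ * a (+ (ℓ ℕ.^ (2 ℕ.* m ℕ.∸ 2)) ℤ.* n))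
proposition2p3 R λ' zero ℓ-prime = ⊥-elim (¬prime[0] ℓ-prime)
proposition2p3 R λ' (suc k) _ ℓinv _ χℓ _ a =
    (λ n j → trans (reflexive (≡.cong (λ t → b a (suc j) (+ t ℤ.* n) - c₂ * b a j n) ℓ^2≡ℓ*ℓ))
      (trans (b-ℓ²· a n j) (+-congʳ (a-ℓ^-cong n (2[1+j]≡2j+2 (suc j))))))
  , (λ { n ℓ∤n (suc m) _ → trans (b-ℓ∤ a n ℓ∤n m)
      (+-congˡ (*-congˡ (sum1to-cong (suc m) (λ j → sym (summand≈[-c₁]^j a n (suc m) j))))) })
  , (λ { n ℓ∣n ℓ²∤n (suc m) _ →
      trans (b-ℓ∥ a n ℓ∣n (ℓ²∤n ∘ ≡.subst (ℕ._∣ ∣ n ∣) (≡.sym ℓ^2≡ℓ*ℓ)) m)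
      (+-congˡ (-‿cong (*-congˡ (a-ℓ^-cong n (ℕ.*-distribˡ-∸ 2 (suc m) 1))))) })
  where
  open CommutativeRing R
  open CommutativeRingFacts R using (sum1to-cong)
  open Dilation k
  open HeckeRecursion R λ' k ℓinv χℓ
  open Hecke R λ' ℓ ℓinv χℓ

  a-ℓ^-cong : ∀ {e f} n → e ≡ f → a (+ (ℓ ℕ.^ e) ℤ.* n) ≈ a (+ (ℓ ℕ.^ f) ℤ.* n)
  a-ℓ^-cong n e≡f = reflexive (≡.cong (λ e → a (+ (ℓ ℕ.^ e) ℤ.* n)) e≡f)
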